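{- There is a positive existential formula $CO(x)$ in the language $\{0,1,+,\mid,R,T\}$ such that for every prime $p$ and every $n\in\mathbb{Z}$: $\mathfrak{D}_p\models CO(n)$ if and only if $p\nmid n$.
   Context: $\mathfrak{D}_p=(\mathbb{Z};0,1,+,\mid,\mid_p,\mathbb{Z}\smallsetminus\{ -1,0,1\})$, where $\mid$ is usual divisibility, $R$ is interpreted as $\mid_p$ (i.e. $x\mid_p y$ iff $y=\pm xp^s$ for some $s\in\mathbb{Z}$), and the unary symbol $T$ is interpreted as $\mathbb{Z}\smallsetminus\{ -1,0,1\}$. -}

module Defs where

open import Data.Nat using (ℕ)
open import Data.Fin using (Fin)
open import Data.Integer using (ℤ; +_; -_; _+_; _*_; _^_)
open import Data.Integer.Divisibility using (_∣_)
open import Data.Product using (Σ; _×_; ∃-syntax)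
open import Data.Sum using (_⊎_)
open import Data.Vec.Functional using (_∷_)
open import Relation.Binary.PropositionalEquality using (_≡_)
open import Relation.Nullary using (¬_)

data Term (n : ℕ) : Set where
  var  : Fin n → Term n
  zer  : Term n
  one  : Term n
  plus : Term n → Term n → Term n

data PEForm : ℕ → Set where
  eqA  : ∀ {n} → Term n → Term n → PEForm n
  divA : ∀ {n} → Term n → Term n → PEForm n
  RA   : ∀ {n} → Term n → Term n → PEForm n
  TA   : ∀ {n} → Term n → PEForm n
  andF : ∀ {n} → PEForm n → PEForm n → PEForm n
  orF  : ∀ {n} → PEForm n → PEForm n → PEForm n
  exF  : ∀ {n} → PEForm (Data.Nat.suc n) → PEForm n

-- x ∣_p y  iff  y = ± x p^s for some s ∈ ℤ.
-- For s = k ≥ 0 this is y = ± x p^k; for s = -k < 0 it is y = ± x / p^k,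
-- i.e. (in ℤ) x = ± y p^k.
_∣[_]_ : ℤ → ℕ → ℤ → Set
x ∣[ p ] y = ∃[ k ] ((y ≡ x * (+ p) ^ k) ⊎ (y ≡ - (x * (+ p) ^ k))
                   ⊎ (x ≡ y * (+ p) ^ k) ⊎ (x ≡ - (y * (+ p) ^ k)))

TSet : ℤ → Set
TSet x = ¬ (x ≡ - (+ 1)) × ¬ (x ≡ + 0) × ¬ (x ≡ + 1)

evalT : ∀ {n} → (Fin n → ℤ) → Term n → ℤ
evalT ρ (var i)    = ρ i
evalT ρ zer        = + 0
evalT ρ one        = + 1
evalT ρ (plus s t) = evalT ρ s + evalT ρ t

Sat : (p : ℕ) → ∀ {n} → PEForm n → (Fin n → ℤ) → Set
Sat p (eqA s t)  ρ = evalT ρ s ≡ evalT ρ t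
Sat p (divA s t) ρ = evalT ρ s ∣ evalT ρ t
Sat p (RA s t)   ρ = evalT ρ s ∣[ p ] evalT ρ t
Sat p (TA t)     ρ = TSet (evalT ρ t)
Sat p (andF φ ψ) ρ = Sat p φ ρ × Sat p ψ ρ
Sat p (orF φ ψ)  ρ = Sat p φ ρ ⊎ Sat p ψ ρ
Sat p (exF φ)    ρ = Σ ℤ (λ z → Sat p φ (z ∷ ρ))

module Submission where

-- Take the formula
--     CO(n)  :=  ∃ q ∃ x.  R(1,q) ∧ T(q) ∧ n ∣ x ∧ q ∣ x + 1.
-- The elements q with R(1,q) are exactly ±p^k, so R(1,q) ∧ T(q) says that
-- q is a nontrivial power of p up to sign, in particular p ∣ q.
--
-- (⇒) If p ∣ n, then p divides both x (through n) and x + 1 (through q),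
--     hence p ∣ 1, which is impossible.
-- (⇐) If p ∤ n, then n and p are coprime, and Bézout's identity gives an
--     x with n ∣ x and p ∣ x + 1; take q = p.

open import Defs
open import Data.Nat using (ℕ)
open import Data.Nat.Primality using (Prime)
open import Data.Integer using (ℤ; +_)
open import Data.Integer.Divisibility using (_∣_)
open import Data.Product using (∃-syntax)
open import Data.Vec.Functional using (_∷_; [])
open import Function.Bundles using (_⇔_)
open import Relation.Nullary using (¬_)

open import Data.Fin using (zero; suc)
open import Data.Product using (_,_; _×_)
open import Data.Sum using (inj₁; inj₂)
open import Data.Empty using (⊥-elim)
open import Function.Bundles using (mk⇔)
open import Relation.Binary.PropositionalEquality
import Data.Nat as ℕ
import Data.Nat.Properties as ℕP
import Data.Nat.Divisibility as ℕD
open import Data.Integer using (∣_∣; -_; -[1+_]; _^_)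
import Data.Integer as ℤ
import Data.Integer.Properties as ℤP
import Data.Integer.Divisibility.Signed as Signed
open import Data.Nat.Primality using (prime⇒irreducible; prime⇒nonTrivial)
open import Data.Nat.Coprimality using (Coprime; coprime-Bézout)
open import Data.Nat.GCD using (module Bézout)

-- The formula CO(x₀) = ∃ q ∃ x. R(1,q) ∧ T(q) ∧ x₀ ∣ x ∧ q ∣ x + 1,
-- in de Bruijn notation (var 0 = x, var 1 = q, var 2 = x₀).
CO : PEForm 1
CO = exF (exF (andF (RA one (var (suc zero)))
              (andF (TA (var (suc zero)))
              (andF (divA (var (suc (suc zero))) (var zero))
                    (divA (var (suc zero)) (plus (var zero) one))))))

abs-power : ∀ m k → ∣ (+ m) ^ k ∣ ≡ m ℕ.^ k
abs-power m ℕ.zero    = refl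
abs-power m (ℕ.suc k) =
  trans (ℤP.abs-* (+ m) ((+ m) ^ k)) (cong (m ℕ.*_) (abs-power m k))

-- The p-associates of 1 are, up to sign, powers of p.  (This holds for
-- every base p: in the case 1 = ±q·p^k the factor q is itself a unit.)
associate-of-one⇒power : ∀ {p q} → (+ 1) ∣[ p ] q → ∃[ k ] (∣ q ∣ ≡ p ℕ.^ k)
associate-of-one⇒power {p} {q} (k , inj₁ q≡p^k) =
  k , trans (cong ∣_∣ (trans q≡p^k (ℤP.*-identityˡ _))) (abs-power p k)
associate-of-one⇒power {p} {q} (k , inj₂ (inj₁ q≡-p^k)) =
  k , trans (cong ∣_∣ q≡-p^k) (trans (ℤP.∣-i∣≡∣i∣ (+ 1 ℤ.* (+ p) ^ k))
          (trans (cong ∣_∣ (ℤP.*-identityˡ ((+ p) ^ k))) (abs-power p k)))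
associate-of-one⇒power {p} {q} (k , inj₂ (inj₂ (inj₁ 1≡qp^k))) =
  0 , ℕP.m*n≡1⇒m≡1 ∣ q ∣ ∣ (+ p) ^ k ∣
        (sym (trans (cong ∣_∣ 1≡qp^k) (ℤP.abs-* q _)))
associate-of-one⇒power {p} {q} (k , inj₂ (inj₂ (inj₂ 1≡-qp^k))) =
  0 , ℕP.m*n≡1⇒m≡1 ∣ q ∣ ∣ (+ p) ^ k ∣
        (sym (trans (cong ∣_∣ 1≡-qp^k) (trans (ℤP.∣-i∣≡∣i∣ (q ℤ.* _)) (ℤP.abs-* q _))))

T⇒abs≢1 : ∀ {q} → TSet q → ¬ (∣ q ∣ ≡ 1)
T⇒abs≢1 {+ .1}         (_ , _ , q≢1)  refl = q≢1 refl
T⇒abs≢1 { -[1+ .0 ]}   (q≢-1 , _ , _) refl = q≢-1 refl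

-- R(1,q) ∧ T(q) forces p ∣ q: q is ±p^k with k ≠ 0.
associate-of-one∧T⇒p∣ : ∀ {p q} → (+ 1) ∣[ p ] q → TSet q → + p ∣ q
associate-of-one∧T⇒p∣ {p} {q} q~1 Tq with associate-of-one⇒power q~1
... | ℕ.zero  , ∣q∣≡1    = ⊥-elim (T⇒abs≢1 Tq ∣q∣≡1)
... | ℕ.suc k , ∣q∣≡p^sk = subst (p ℕD.∣_) (sym ∣q∣≡p^sk) (ℕD.m∣m*n (p ℕ.^ k))

prime∤⇒coprime : ∀ {p m} → Prime p → ¬ (p ℕD.∣ m) → Coprime m p
prime∤⇒coprime pp p∤m (d∣m , d∣p) with prime⇒irreducible pp d∣p
... | inj₁ d≡1 = d≡1
... | inj₂ refl = ⊥-elim (p∤m d∣m)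

-- If m and d are coprime there is a multiple x of m with d ∣ x + 1
-- (Bézout's identity, read modulo d).
coprime⇒complementary-multiple : ∀ {m d} → Coprime m d →
                                  ∃[ x ] ((+ m ∣ x) × (+ d ∣ x ℤ.+ + 1))
coprime⇒complementary-multiple {m} {d} m⊥d with coprime-Bézout m⊥d
... | Bézout.+- a b 1+bd≡am =
  -[1+ b ℕ.* d ] ,
  subst (m ℕD.∣_) (sym 1+bd≡am) (ℕD.n∣m*n a) ,
  subst (λ y → d ℕD.∣ ∣ y ∣) (sym x+1≡-bd)
        (subst (d ℕD.∣_) (sym (ℤP.∣-i∣≡∣i∣ (+ (b ℕ.* d)))) (ℕD.n∣m*n b))
  where
  x+1≡-bd : -[1+ b ℕ.* d ] ℤ.+ + 1 ≡ - (+ (b ℕ.* d))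
  x+1≡-bd = trans (ℤP.+-comm -[1+ b ℕ.* d ] (+ 1)) (ℤP.1-[1+n]≡-n (b ℕ.* d))
... | Bézout.-+ a b 1+am≡bd =
  + (a ℕ.* m) ,
  ℕD.n∣m*n a ,
  subst (d ℕD.∣_) (trans (sym 1+am≡bd) (ℕP.+-comm 1 (a ℕ.* m))) (ℕD.n∣m*n b)

module _ {p : ℕ} (pp : Prime p) where

  p≢1 : ¬ (p ≡ 1)
  p≢1 refl with prime⇒nonTrivial pp
  ... | ()

  p∈T : TSet (+ p)
  p∈T = (λ ()) , (λ p≡0 → p≢0 (ℤP.+-injective p≡0)) , (λ p≡1 → p≢1 (ℤP.+-injective p≡1))
    where
    p≢0 : ¬ (p ≡ 0)
    p≢0 refl with prime⇒nonTrivial pp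
    ... | ()

  p~1 : (+ 1) ∣[ p ] (+ p)
  p~1 = 1 , inj₁ (sym (trans (ℤP.*-identityˡ _) (ℤP.*-identityʳ (+ p))))

  CO⇒p∤ : ∀ n → Sat p CO (n ∷ []) → ¬ (+ p ∣ n)
  CO⇒p∤ n (q , x , q~1 , Tq , n∣x , q∣x+1) p∣n =
    p≢1 (ℕD.∣1⇒≡1 (Signed.∣⇒∣ᵤ (Signed.∣m+n∣m⇒∣n p∣x+1 p∣x)))
    where
    p∣x : + p Signed.∣ x
    p∣x = Signed.∣-trans (Signed.∣ᵤ⇒∣ {+ p} {n} p∣n) (Signed.∣ᵤ⇒∣ {n} {x} n∣x)
    p∣x+1 : + p Signed.∣ x ℤ.+ + 1
    p∣x+1 = Signed.∣-trans (Signed.∣ᵤ⇒∣ {+ p} {q} (associate-of-one∧T⇒p∣ q~1 Tq))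
                           (Signed.∣ᵤ⇒∣ {q} {x ℤ.+ + 1} q∣x+1)

  p∤⇒CO : ∀ n → ¬ (+ p ∣ n) → Sat p CO (n ∷ [])
  p∤⇒CO n p∤n with coprime⇒complementary-multiple (prime∤⇒coprime pp p∤n)
  ... | x , n∣x , p∣x+1 = + p , x , p~1 , p∈T , n∣x , p∣x+1

lemma4p10 : ∃[ CO ] ((p : ℕ) → Prime p → (n : ℤ) →
    (Sat p CO (n ∷ []) ⇔ (¬ ((+ p) ∣ n))))
lemma4p10 = CO , λ p pp n → mk⇔ (CO⇒p∤ pp n) (p∤⇒CO pp n)
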